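{- Let $i,j$ be positive integers, let $D$ be an $(i,j)$ digraph, and let $N$ be a subset of the set of neighbors of some vertex $u$ in $P(D)$. If, for some positive integer $k$, no $k$ vertices of $N$ form a clique in $P(D)$, then $|N| \leq (k-1)(j+1)$.
   Context: An $(i,j)$ digraph is an acyclic digraph in which every vertex has indegree at most $i$ and outdegree at most $j$. The phylogeny graph $P(D)$ has vertex set $V(D)$ and an edge between distinct $u,v$ iff $(u,v)\in A(D)$ or $(v,u)\in A(D)$ or $u,v$ have a common out-neighbor in $D$. -}

module Defs where

open import Data.Nat using (ℕ; zero; suc; _≤_; _*_; _∸_)
open import Data.Bool using (Bool; true; false)
open import Data.Fin using (Fin)
open import Data.Fin.Subset using (Subset; _∈_; _⊆_; ∣_∣)
open import Data.Vec using (tabulate)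
open import Data.Product using (_×_; ∃-syntax)
open import Data.Sum using (_⊎_)
open import Relation.Binary.PropositionalEquality using (_≡_; _≢_)
open import Relation.Nullary using (¬_)

record Digraph (n : ℕ) : Set where
  field
    arc : Fin n → Fin n → Bool

module _ {n : ℕ} (D : Digraph n) where
  open Digraph D

  Arc : Fin n → Fin n → Set
  Arc u v = arc u v ≡ true

  data Reach : Fin n → Fin n → Set where
    step : ∀ {u v} → Arc u v → Reach u v
    cons : ∀ {u v w} → Arc u v → Reach v w → Reach u w

  Acyclic : Set
  Acyclic = ∀ v → ¬ Reach v v

  outNbrs : Fin n → Subset n
  outNbrs v = tabulate (λ w → arc v w)

  inNbrs : Fin n → Subset n
  inNbrs v = tabulate (λ w → arc w v)

  outdeg : Fin n → ℕ
  outdeg v = ∣ outNbrs v ∣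

  indeg : Fin n → ℕ
  indeg v = ∣ inNbrs v ∣

  IsIJDigraph : ℕ → ℕ → Set
  IsIJDigraph i j = Acyclic × (∀ v → indeg v ≤ i) × (∀ v → outdeg v ≤ j)

  PEdge : Fin n → Fin n → Set
  PEdge u v = u ≢ v × (Arc u v ⊎ Arc v u ⊎ (∃[ w ] (Arc u w × Arc v w)))

  IsPClique : Subset n → Set
  IsPClique S = ∀ x y → x ∈ S → y ∈ S → x ≢ y → PEdge x y

{-# OPTIONS --safe #-}
module Submission where

-- Every neighbour v of u in P(D) is an in-neighbour of u, an out-neighbour of u, or shares
-- an out-neighbour w with u. Hence N is covered by the closed in-neighbourhoods {w} ∪ N⁻(w)
-- of u and of its at most j out-neighbours w. Each of these is a clique of P(D), so it meets
-- N in at most k − 1 vertices.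

open import Defs
open import Data.Nat using (ℕ; zero; suc; _≤_; _<_; _*_; _∸_; _+_; s≤s; s≤s⁻¹; _≤?_)
open import Data.Nat.Properties using (+-suc; +-mono-≤; *-comm; *-monoˡ-≤; ≤-trans; ≤-reflexive; ≰⇒>; module ≤-Reasoning)
open import Data.Bool using (Bool; true)
open import Data.Fin using (Fin; zero; suc)
open import Data.Fin.Subset using (Subset; _∈_; _⊆_; ∣_∣; _∩_; _∪_; ∁; ⁅_⁆; ⊥; inside; outside)
open import Data.Fin.Subset.Properties using (⊥⊆; ⊆-trans; ∣⊥∣≡0; p⊆q⇒∣p∣≤∣q∣; s⊆s; Empty-unique; x∈p∩q⁺; x∈p∩q⁻; p∩q⊆p; p∩q⊆q; x∈p∪q⁺; x∈p∪q⁻; x∈⁅x⁆; x∈⁅y⁆⇒x≡y; x∈∁p⇒x∉p)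
open import Data.Vec using ([]; _∷_; tabulate; here; there)
open import Data.Vec.Properties using (lookup∘tabulate; []=⇒lookup; lookup⇒[]=)
open import Data.Product using (_×_; ∃-syntax; _,_)
open import Data.Sum using (_⊎_; inj₁; inj₂)
open import Relation.Binary.PropositionalEquality using (_≡_; refl; sym; trans; cong)
open import Relation.Nullary using (¬_; yes; no; contradiction)

∣p∣≡∣p∩q∣+∣p∩∁q∣ : ∀ {n} (p q : Subset n) → ∣ p ∣ ≡ ∣ p ∩ q ∣ + ∣ p ∩ ∁ q ∣
∣p∣≡∣p∩q∣+∣p∩∁q∣ []            []            = refl
∣p∣≡∣p∩q∣+∣p∩∁q∣ (outside ∷ p) (_       ∷ q) = ∣p∣≡∣p∩q∣+∣p∩∁q∣ p q
∣p∣≡∣p∩q∣+∣p∩∁q∣ (inside  ∷ p) (inside  ∷ q) = cong suc (∣p∣≡∣p∩q∣+∣p∩∁q∣ p q)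
∣p∣≡∣p∩q∣+∣p∩∁q∣ (inside  ∷ p) (outside ∷ q) =
  trans (cong suc (∣p∣≡∣p∩q∣+∣p∩∁q∣ p q)) (sym (+-suc ∣ p ∩ q ∣ ∣ p ∩ ∁ q ∣))

⊆-ofSize : ∀ {n} (p : Subset n) k → k ≤ ∣ p ∣ → ∃[ q ] (q ⊆ p × ∣ q ∣ ≡ k)
⊆-ofSize {n} p         zero    _           = ⊥ , ⊥⊆ , ∣⊥∣≡0 n
⊆-ofSize (outside ∷ p) (suc k) 1+k≤∣p∣     with ⊆-ofSize p (suc k) 1+k≤∣p∣
... | q , q⊆p , ∣q∣≡k = outside ∷ q , s⊆s q⊆p , ∣q∣≡k
⊆-ofSize (inside ∷ p)  (suc k) (s≤s k≤∣p∣) with ⊆-ofSize p k k≤∣p∣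
... | q , q⊆p , ∣q∣≡k = inside ∷ q , s⊆s q⊆p , cong suc ∣q∣≡k

∣∣≤-cover : ∀ {k n m} (O : Subset k) (C : Fin k → Subset n) {N : Subset n} →
  (∀ w → ∣ C w ∣ ≤ m) → (∀ {v} → v ∈ N → ∃[ w ] (w ∈ O × v ∈ C w)) →
  ∣ N ∣ ≤ ∣ O ∣ * m
∣∣≤-cover {n = n} [] C _ cover =
  ≤-reflexive (trans (cong ∣_∣ (Empty-unique λ { (v , v∈N) → noIndex (cover v∈N) })) (∣⊥∣≡0 n))
  where
  noIndex : ∀ {v} → ¬ (∃[ w ] (w ∈ [] × v ∈ C w))
  noIndex (() , _)
∣∣≤-cover (outside ∷ O) C {N} ∣C∣≤m cover = ∣∣≤-cover O (λ w → C (suc w)) (λ w → ∣C∣≤m (suc w)) cover′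
  where
  cover′ : ∀ {v} → v ∈ N → ∃[ w ] (w ∈ O × v ∈ C (suc w))
  cover′ v∈N with cover v∈N
  ... | suc w , there w∈O , v∈C = w , w∈O , v∈C
∣∣≤-cover {m = m} (inside ∷ O) C {N} ∣C∣≤m cover = begin
  ∣ N ∣                             ≡⟨ ∣p∣≡∣p∩q∣+∣p∩∁q∣ N (C zero) ⟩
  ∣ N ∩ C zero ∣ + ∣ N ∩ ∁ (C zero) ∣ ≤⟨ +-mono-≤ (≤-trans (p⊆q⇒∣p∣≤∣q∣ (p∩q⊆q N (C zero))) (∣C∣≤m zero)) rest ⟩
  m + ∣ O ∣ * m                     ∎
  where
  open ≤-Reasoning
  cover′ : ∀ {v} → v ∈ N ∩ ∁ (C zero) → ∃[ w ] (w ∈ O × v ∈ C (suc w))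
  cover′ v∈N∖C with x∈p∩q⁻ N _ v∈N∖C
  ... | v∈N , v∈∁C with cover v∈N
  ... | zero  , _         , v∈C = contradiction v∈C (x∈∁p⇒x∉p v∈∁C)
  ... | suc w , there w∈O , v∈C = w , w∈O , v∈C
  rest : ∣ N ∩ ∁ (C zero) ∣ ≤ ∣ O ∣ * m
  rest = ∣∣≤-cover O (λ w → C (suc w)) (λ w → ∣C∣≤m (suc w)) cover′

x∈tabulate⁺ : ∀ {n} {f : Fin n → Bool} {x} → f x ≡ true → x ∈ tabulate f
x∈tabulate⁺ {f = f} {x} fx = lookup⇒[]= x (tabulate f) (trans (lookup∘tabulate f x) fx)

x∈tabulate⁻ : ∀ {n} {f : Fin n → Bool} {x} → x ∈ tabulate f → f x ≡ true
x∈tabulate⁻ {f = f} {x} x∈f = trans (sym (lookup∘tabulate f x)) ([]=⇒lookup x∈f)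

module _ {n : ℕ} (D : Digraph n) where

  closedInNbrs : Fin n → Subset n
  closedInNbrs w = ⁅ w ⁆ ∪ inNbrs D w

  closedInNbrs-isPClique : ∀ w → IsPClique D (closedInNbrs w)
  closedInNbrs-isPClique w x y x∈ y∈ x≢y = x≢y , edge (member x∈) (member y∈)
    where
    member : ∀ {v} → v ∈ closedInNbrs w → v ≡ w ⊎ Arc D v w
    member v∈ with x∈p∪q⁻ ⁅ w ⁆ (inNbrs D w) v∈
    ... | inj₁ v∈⁅w⁆ = inj₁ (x∈⁅y⁆⇒x≡y w v∈⁅w⁆)
    ... | inj₂ v∈in  = inj₂ (x∈tabulate⁻ v∈in)
    edge : x ≡ w ⊎ Arc D x w → y ≡ w ⊎ Arc D y w →
           Arc D x y ⊎ Arc D y x ⊎ ∃[ z ] (Arc D x z × Arc D y z)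
    edge (inj₁ refl) (inj₁ refl) = contradiction refl x≢y
    edge (inj₁ refl) (inj₂ yx)   = inj₂ (inj₁ yx)
    edge (inj₂ xy)   (inj₁ refl) = inj₁ xy
    edge (inj₂ xw)   (inj₂ yw)   = inj₂ (inj₂ (w , xw , yw))

  isPClique-⊆ : ∀ {S T} → S ⊆ T → IsPClique D T → IsPClique D S
  isPClique-⊆ S⊆T T-clique x y x∈S y∈S = T-clique x y (S⊆T x∈S) (S⊆T y∈S)

  HasPCliqueOfSize : Subset n → ℕ → Set
  HasPCliqueOfSize N k = ∃[ S ] (S ⊆ N × ∣ S ∣ ≡ k × IsPClique D S)

  ∣pclique∣< : ∀ {N S} k → ¬ HasPCliqueOfSize N k → S ⊆ N → IsPClique D S → ∣ S ∣ < k
  ∣pclique∣< {N} {S} k noClique S⊆N S-clique with k ≤? ∣ S ∣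
  ... | no  k≰∣S∣ = ≰⇒> k≰∣S∣
  ... | yes k≤∣S∣ with ⊆-ofSize S k k≤∣S∣
  ...   | T , T⊆S , ∣T∣≡k =
    contradiction (T , (λ {_} → ⊆-trans T⊆S S⊆N) , ∣T∣≡k , isPClique-⊆ T⊆S S-clique) noClique

  module _ (u : Fin n) (N : Subset n) where

    centre : Fin (suc n) → Fin n
    centre zero    = u
    centre (suc w) = w

    piece : Fin (suc n) → Subset n
    piece x = N ∩ closedInNbrs (centre x)

    piece-isPClique : ∀ x → IsPClique D (piece x)
    piece-isPClique x = isPClique-⊆ (p∩q⊆q N _) (closedInNbrs-isPClique (centre x))

    pieces-cover : (∀ v → v ∈ N → PEdge D u v) →
      ∀ {v} → v ∈ N → ∃[ x ] (x ∈ inside ∷ outNbrs D u × v ∈ piece x)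
    pieces-cover N⊆nbhd {v} v∈N with N⊆nbhd v v∈N
    ... | _ , inj₁ uv =
      suc v , there (x∈tabulate⁺ uv) , x∈p∩q⁺ (v∈N , x∈p∪q⁺ (inj₁ (x∈⁅x⁆ v)))
    ... | _ , inj₂ (inj₁ vu) =
      zero , here , x∈p∩q⁺ (v∈N , x∈p∪q⁺ (inj₂ (x∈tabulate⁺ vu)))
    ... | _ , inj₂ (inj₂ (w , uw , vw)) =
      suc w , there (x∈tabulate⁺ uw) , x∈p∩q⁺ (v∈N , x∈p∪q⁺ (inj₂ (x∈tabulate⁺ vw)))

proposition3p1 : (i j : ℕ) → 1 ≤ i → 1 ≤ j → {n : ℕ} → (D : Digraph n) →
    IsIJDigraph D i j → (u : Fin n) → (N : Subset n) →
    (∀ v → v ∈ N → PEdge D u v) → (k : ℕ) → 1 ≤ k →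
    ¬ (∃[ S ] (S ⊆ N × ∣ S ∣ ≡ k × IsPClique D S)) →
    ∣ N ∣ ≤ (k ∸ 1) * suc j
proposition3p1 _ j _ _ D (_ , _ , outdeg≤j) u N N⊆nbhd (suc k) _ noClique = begin
  ∣ N ∣                    ≤⟨ ∣∣≤-cover (inside ∷ outNbrs D u) (piece D u N) ∣piece∣≤k (pieces-cover D u N N⊆nbhd) ⟩
  suc (outdeg D u) * k     ≤⟨ *-monoˡ-≤ k (s≤s (outdeg≤j u)) ⟩
  suc j * k                ≡⟨ *-comm (suc j) k ⟩
  k * suc j                ∎
  where
  open ≤-Reasoning
  ∣piece∣≤k : ∀ x → ∣ piece D u N x ∣ ≤ k
  ∣piece∣≤k x = s≤s⁻¹ (∣pclique∣< D (suc k) noClique (p∩q⊆p N _) (piece-isPClique D u N x))
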